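{- Let $H$ be a non-empty graph isomorphic to an induced subgraph of $Q_k$ for some $k$, and let $l = |H|$. Then there is a $(1 \bmod l)$-partition of $(P_{2l})^k$ into induced copies of $H$.
   Context: $Q_k$ is the $k$-dimensional hypercube on $\{0,1\}^k$; $P_m$ is the path on $m$ vertices; $|H|$ is the number of vertices of $H$. For graphs $G_1,G_2$ the Cartesian product $G_1\times G_2$ has vertex set $V(G_1)\times V(G_2)$, with $(u_1,u_2)\sim(v_1,v_2)$ iff either $u_1=v_1$ and $u_2v_2\in E(G_2)$, or $u_2=v_2$ and $u_1v_1\in E(G_1)$; $G^k$ is the product of $k$ copies of $G$. An induced copy of $H$ in $G$ is an induced subgraph of $G$ isomorphic to $H$. A $(1 \bmod l)$-partition of $G$ into induced copies of $H$ is a finite multiset (copies may be repeated) of induced copies of $H$ in $G$ such that every vertex of $G$ lies in a number of members of the multiset (counted with multiplicity) that is congruent to $1$ modulo $l$. -}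

module Defs where

open import Data.Nat using (ℕ; zero; suc; _*_; _%_)
import Data.Nat
open import Data.Bool using (Bool)
open import Data.Fin using (Fin; toℕ)
open import Data.Fin.Properties using (any?)
import Data.Fin.Properties as FinP
open import Data.Vec using (Vec; []; _∷_; lookup)
open import Data.Vec.Properties using (≡-dec)
open import Data.List using (List; length; filter)
open import Data.Product using (Σ; ∃; _×_; _,_)
open import Data.Sum using (_⊎_)
open import Relation.Nullary using (¬_; Dec)
open import Relation.Binary.PropositionalEquality using (_≡_; _≢_)
open import Function using (_⇔_; Injective)

record Graph (V : Set) : Set₁ where
  field
    Adj    : V → V → Set
    sym    : ∀ {x y} → Adj x y → Adj y x
    irrefl : ∀ {x} → ¬ Adj x x
open Graph public

QAdj : (k : ℕ) → Vec Bool k → Vec Bool k → Set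
QAdj k x y = Σ (Fin k) λ i → (lookup x i ≢ lookup y i) ×
               (∀ j → j ≢ i → lookup x j ≡ lookup y j)

PAdj : (m : ℕ) → Fin m → Fin m → Set
PAdj m a b = (suc (toℕ a) ≡ toℕ b) ⊎ (suc (toℕ b) ≡ toℕ a)

-- Adjacency of the Cartesian power G^k, built as iterated products
-- G^(k+1) = G × G^k with vertex (x ∷ xs) ~ (x , xs).
PowAdj : {V : Set} → (V → V → Set) → (k : ℕ) → Vec V k → Vec V k → Set
PowAdj A zero [] [] = Data.Empty.⊥ where import Data.Empty
PowAdj A (suc k) (x ∷ xs) (y ∷ ys) =
  (x ≡ y × PowAdj A k xs ys) ⊎ (xs ≡ ys × A x y)

-- Induced embedding of H into G: injective map preserving and reflecting adjacency.
-- Its image is an induced copy of H in G.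
-- (Graphs are given by their adjacency relations here.)
record InducedEmb {A B : Set} (R : A → A → Set) (S : B → B → Set) : Set where
  field
    f       : A → B
    inj     : Injective _≡_ _≡_ f
    adj⇔    : ∀ u v → R u v ⇔ S (f u) (f v)
open InducedEmb public

PVert : ℕ → ℕ → Set
PVert m k = Vec (Fin m) k

covers? : ∀ {l m k} {R : Fin l → Fin l → Set} {S : PVert m k → PVert m k → Set}
          (v : PVert m k) (e : InducedEmb R S) → Dec (∃ λ u → f e u ≡ v)
covers? v e = any? (λ u → ≡-dec FinP._≟_ (f e u) v)

multiplicity : ∀ {l m k} {R : Fin l → Fin l → Set} {S : PVert m k → PVert m k → Set}
               → List (InducedEmb R S) → PVert m k → ℕ
multiplicity cs v = length (filter (covers? v) cs)

One-mod-Partition : (l m k : ℕ) .{{_ : Data.Nat.NonZero l}} (R : Fin l → Fin l → Set) → Set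
One-mod-Partition l m k R =
  Σ (List (InducedEmb R (PowAdj (PAdj m) k))) λ cs →
    ∀ (v : PVert m k) → multiplicity cs v % l ≡ 1 % l

module Submission where

-- A k-tuple E of arcs (oriented edges) of a graph G embeds Q_k as an induced subgraph of G^k,
-- sending x to the point whose i-th coordinate is the tail of Eᵢ if xᵢ = 1 and its head
-- otherwise; composing with H ⊆ Q_k gives a copy of H for every such tuple.
-- Fix the image c ∈ Q_k of some vertex of H, and let Eᵢ range over a multiset L(cᵢ) of arcs
-- of the path, where in L(1) every vertex is the tail of ≡ 1 and the head of ≡ 0 arcs
-- (mod l), and L(0) consists of the reversed arcs of L(1).  For fixed x ∈ Q_k the number of
-- tuples E mapping x to a given vertex v is then ≡ ∏ᵢ [xᵢ = cᵢ] = [x = c], so summing over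
-- the vertices x of H, v lies in ≡ 1 of the copies.  On the path with 2l vertices, L(1) is
-- built from ⌈(a+1)/2⌉ copies of the arc a → a+1 and l − ⌈a/2⌉ copies of a+1 → a.

open import Defs hiding (sym)

open import Data.Bool using (Bool; true; false; not; if_then_else_; T)
import Data.Bool as Bool
open import Data.Empty using (⊥; ⊥-elim)
open import Data.Fin using (Fin; zero; suc; toℕ; inject₁)
open import Data.Fin.Properties using (any?; toℕ-inject₁; toℕ<n)
import Data.Fin.Properties as Fin
open import Data.List using (List; []; _∷_; _++_; map; concat; tabulate; replicate; length; filter; cartesianProductWith)
open import Data.List.Properties using (map-++; map-∘; map-cong)
open import Data.Nat using (ℕ; zero; suc; _+_; _*_; _∸_; _%_; _≤_; _<_; s≤s; NonZero; _≡ᵇ_; ⌈_/2⌉; ⌊_/2⌋)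
open import Data.Nat.DivMod using (%-distribˡ-+; %-distribˡ-*; [m+n]%n≡m%n)
open import Data.Nat.ListAction using (sum)
open import Data.Nat.ListAction.Properties using (sum-++)
open import Data.Nat.Properties
open import Data.Nat.Tactic.RingSolver using (solve-∀)
open import Algebra.Properties.CommutativeMonoid.Sum +-0-commutativeMonoid
  using (sum-syntax; ∑-distrib-+; sum-cong-≗; sum-replicate-zero)
open import Data.Product using (∃; _×_; _,_; proj₁; proj₂)
open import Data.Product.Function.NonDependent.Propositional using (_×-⇔_)
open import Data.Sum using (inj₁; inj₂; swap)
open import Data.Sum.Function.Propositional using (_⊎-⇔_)
open import Data.Vec using (Vec; []; _∷_)
import Data.Vec as Vec
open import Data.Vec.Properties using (∷-injectiveˡ; ∷-injectiveʳ; ≡-dec)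
open import Data.Vec.Relation.Binary.Pointwise.Extensional using (ext; Pointwise-≡⇒≡)
open import Function using (_∘_; id; _⇔_; mk⇔)
open import Function.Construct.Composition using (_⇔-∘_)
open import Function.Construct.Symmetry using (⇔-sym)
open import Level using (Level)
open import Relation.Binary using (DecidableEquality)
open import Relation.Binary.PropositionalEquality
open import Relation.Nullary using (yes; no; does)
open import Relation.Nullary.Decidable using (does-⇔; dec-true; T?)
open import Relation.Unary using (Pred; Decidable)

private
  variable
    A B C V : Set
    R : A → A → Set
    S : B → B → Set
    U : C → C → Set
    k : ℕ
    ℓ : Level

cong⇔ : (e : InducedEmb R S) {x y : A} → x ≡ y ⇔ f e x ≡ f e y
cong⇔ e = mk⇔ (cong (f e)) (inj e)

_∘ᵉ_ : InducedEmb S U → InducedEmb R S → InducedEmb R U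
g ∘ᵉ h = record
  { f    = f g ∘ f h
  ; inj  = inj h ∘ inj g
  ; adj⇔ = λ u v → adj⇔ g (f h u) (f h v) ⇔-∘ adj⇔ h u v
  }

idᵉ : {R R′ : A → A → Set} → (∀ x y → R x y ⇔ R′ x y) → InducedEmb R R′
idᵉ R⇔R′ = record { f = id ; inj = id ; adj⇔ = R⇔R′ }

powᵉ : Vec (InducedEmb R S) k → InducedEmb (PowAdj R k) (PowAdj S k)
powᵉ [] = record
  { f    = λ _ → []
  ; inj  = λ { {[]} {[]} _ → refl }
  ; adj⇔ = λ { [] [] → mk⇔ id id }
  }
powᵉ (e ∷ es) = record
  { f    = λ { (x ∷ xs) → f e x ∷ f p xs }
  ; inj  = λ { {_ ∷ _} {_ ∷ _} eq → cong₂ _∷_ (inj e (∷-injectiveˡ eq)) (inj p (∷-injectiveʳ eq)) }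
  ; adj⇔ = λ { (x ∷ xs) (y ∷ ys) → (cong⇔ e ×-⇔ adj⇔ p xs ys) ⊎-⇔ (cong⇔ p ×-⇔ adj⇔ e x y) }
  }
  where p = powᵉ es

QAdj⇔PowAdj : ∀ k (x y : Vec Bool k) → QAdj k x y ⇔ PowAdj _≢_ k x y
QAdj⇔PowAdj k x y = mk⇔ (to k x y) (from k x y)
  where
  to : ∀ k (x y : Vec Bool k) → QAdj k x y → PowAdj _≢_ k x y
  to zero    []      []      (() , _)
  to (suc k) (a ∷ x) (b ∷ y) (zero , a≢b , rest) =
    inj₂ (Pointwise-≡⇒≡ (ext λ j → rest (suc j) λ ()) , a≢b)
  to (suc k) (a ∷ x) (b ∷ y) (suc i , xᵢ≢yᵢ , rest) =
    inj₁ (rest zero (λ ()) , to k x y (i , xᵢ≢yᵢ , λ j j≢i → rest (suc j) (j≢i ∘ Fin.suc-injective)))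
  from : ∀ k (x y : Vec Bool k) → PowAdj _≢_ k x y → QAdj k x y
  from zero    []      []       ()
  from (suc k) (a ∷ x) (.a ∷ y) (inj₁ (refl , x~y)) with from k x y x~y
  ... | i , xᵢ≢yᵢ , rest = suc i , xᵢ≢yᵢ , λ { zero _ → refl ; (suc j) j≢ → rest j (j≢ ∘ cong suc) }
  from (suc k) (a ∷ x) (b ∷ .x) (inj₂ (refl , a≢b)) =
    zero , a≢b , λ { zero 0≢0 → ⊥-elim (0≢0 refl) ; (suc j) _ → refl }

path : (m : ℕ) → Graph (Fin m)
path m = record { Adj = PAdj m ; sym = swap ; irrefl = λ { (inj₁ eq) → 1+n≢n eq ; (inj₂ eq) → 1+n≢n eq } }

record Arc (G : Graph V) : Set where
  constructor arc
  field
    tail head : V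
    tail~head : Adj G tail head
open Arc

module _ {G : Graph V} where

  reverse : Arc G → Arc G
  reverse ε = arc (head ε) (tail ε) (Graph.sym G (tail~head ε))

  endpoint : Arc G → Bool → V
  endpoint ε true  = tail ε
  endpoint ε false = head ε

  tail≢head : (ε : Arc G) → tail ε ≢ head ε
  tail≢head ε eq = irrefl G (subst (λ v → Adj G v (head ε)) eq (tail~head ε))

  arcᵉ : Arc G → InducedEmb _≢_ (Adj G)
  arcᵉ ε = record
    { f    = endpoint ε
    ; inj  = λ {a} {b} → endpoint-injective a b
    ; adj⇔ = λ a b → mk⇔ (endpoint-adj a b)
                         λ adj a≡b → irrefl G (subst (λ c → Adj G (endpoint ε c) (endpoint ε b)) a≡b adj)
    }
    where
    endpoint-injective : ∀ a b → endpoint ε a ≡ endpoint ε b → a ≡ b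
    endpoint-injective true  true  _  = refl
    endpoint-injective true  false eq = ⊥-elim (tail≢head ε eq)
    endpoint-injective false true  eq = ⊥-elim (tail≢head ε (sym eq))
    endpoint-injective false false _  = refl
    endpoint-adj : ∀ a b → a ≢ b → Adj G (endpoint ε a) (endpoint ε b)
    endpoint-adj true  true  a≢b = ⊥-elim (a≢b refl)
    endpoint-adj true  false _   = tail~head ε
    endpoint-adj false true  _   = Graph.sym G (tail~head ε)
    endpoint-adj false false a≢b = ⊥-elim (a≢b refl)

  cubeᵉ : Vec (Arc G) k → InducedEmb (PowAdj _≢_ k) (PowAdj (Adj G) k)
  cubeᵉ E = powᵉ (Vec.map arcᵉ E)

  cube : Vec (Arc G) k → Vec Bool k → Vec V k
  cube E = f (cubeᵉ E)

  back-and-forth : ℕ → ℕ → Arc G → List (Arc G)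
  back-and-forth u d ε = replicate u ε ++ replicate d (reverse ε)

  orient : List (Arc G) → Bool → List (Arc G)
  orient L true  = L
  orient L false = map reverse L

cubes : (Bool → List A) → Vec Bool k → List (Vec A k)
cubes L []      = [] ∷ []
cubes L (b ∷ c) = cartesianProductWith _∷_ (L b) (cubes L c)

⟦_⟧ : Bool → ℕ
⟦ true  ⟧ = 1
⟦ false ⟧ = 0

count : (A → Bool) → List A → ℕ
count p xs = sum (map (⟦_⟧ ∘ p) xs)

count-++ : (p : A → Bool) (xs ys : List A) → count p (xs ++ ys) ≡ count p xs + count p ys
count-++ p xs ys = trans (cong sum (map-++ (⟦_⟧ ∘ p) xs ys)) (sum-++ (map (⟦_⟧ ∘ p) xs) _)

count-map : (p : B → Bool) (g : A → B) (xs : List A) → count p (map g xs) ≡ count (p ∘ g) xs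
count-map p g xs = cong sum (sym (map-∘ xs))

count-cong : {p q : A → Bool} → (∀ x → p x ≡ q x) → ∀ xs → count p xs ≡ count q xs
count-cong p≗q xs = cong sum (map-cong (cong ⟦_⟧ ∘ p≗q) xs)

count-replicate : (p : A → Bool) (n : ℕ) (x : A) → count p (replicate n x) ≡ ⟦ p x ⟧ * n
count-replicate p zero    x = sym (*-zeroʳ ⟦ p x ⟧)
count-replicate p (suc n) x = trans (cong (⟦ p x ⟧ +_) (count-replicate p n x)) (sym (*-suc ⟦ p x ⟧ n))

count-false : (xs : List A) → count (λ _ → false) xs ≡ 0
count-false []       = refl
count-false (_ ∷ xs) = count-false xs

count-if : (a b : Bool) (p q : A → Bool) → (T a → T b → ⊥) → ∀ xs →
  count (λ x → if a then p x else if b then q x else false) xs ≡ ⟦ a ⟧ * count p xs + ⟦ b ⟧ * count q xs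
count-if true  true  p q a∧b→⊥ xs = ⊥-elim (a∧b→⊥ _ _)
count-if true  false p q _     xs = sym (trans (+-identityʳ _) (+-identityʳ _))
count-if false true  p q _     xs = sym (+-identityʳ _)
count-if false false p q _     xs = count-false xs

length-filter : {P : Pred A ℓ} (P? : Decidable P) (xs : List A) →
                length (filter P? xs) ≡ count (does ∘ P?) xs
length-filter P? []       = refl
length-filter P? (x ∷ xs) with does (P? x)
... | true  = cong suc (length-filter P? xs)
... | false = length-filter P? xs

count-concat-tabulate : ∀ {n} (p : A → Bool) (xss : Fin n → List A) →
                        count p (concat (tabulate xss)) ≡ ∑[ i < n ] count p (xss i)
count-concat-tabulate {n = zero}  p xss = refl
count-concat-tabulate {n = suc n} p xss =
  trans (count-++ p (xss zero) _) (cong (count p (xss zero) +_) (count-concat-tabulate p (xss ∘ suc)))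

count-cartesianProductWith : (p : C → Bool) (g : A → B → C) (xs : List A) (ys : List B) →
  count p (cartesianProductWith g xs ys) ≡ sum (map (λ x → count (p ∘ g x) ys) xs)
count-cartesianProductWith p g []       ys = refl
count-cartesianProductWith p g (x ∷ xs) ys =
  trans (count-++ p (map (g x) ys) _)
        (cong₂ _+_ (count-map p (g x) ys) (count-cartesianProductWith p g xs ys))

sum-count-linear : (p q : A → Bool) (a b : ℕ) (xs : List A) →
  sum (map (λ x → ⟦ p x ⟧ * a + ⟦ q x ⟧ * b) xs) ≡ count p xs * a + count q xs * b
sum-count-linear p q a b []       = refl
sum-count-linear p q a b (x ∷ xs) =
  trans (cong (⟦ p x ⟧ * a + ⟦ q x ⟧ * b +_) (sum-count-linear p q a b xs))
        (distrib ⟦ p x ⟧ ⟦ q x ⟧ (count p xs) (count q xs) a b)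
  where
  distrib : ∀ s t s′ t′ a b → s * a + t * b + (s′ * a + t′ * b) ≡ (s + s′) * a + (t + t′) * b
  distrib = solve-∀

∑-δ : ∀ {M Y} (g : ℕ → ℕ) → Y < M → ∑[ a < M ] (⟦ toℕ a ≡ᵇ Y ⟧ * g (toℕ a)) ≡ g Y
∑-δ {suc M} {zero}  g _ =
  trans (cong (g 0 + 0 +_) (sum-replicate-zero M)) (trans (+-identityʳ _) (+-identityʳ _))
∑-δ {suc M} {suc Y} g (s≤s Y<M) = ∑-δ (g ∘ suc) Y<M

∑-δ-out : ∀ {M Y} (g : ℕ → ℕ) → M ≤ Y → ∑[ a < M ] (⟦ toℕ a ≡ᵇ Y ⟧ * g (toℕ a)) ≡ 0
∑-δ-out {zero}          g _         = refl
∑-δ-out {suc M} {suc Y} g (s≤s M≤Y) = ∑-δ-out (g ∘ suc) M≤Y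

infix 4 _≡_[mod_]

_≡_[mod_] : ℕ → ℕ → (l : ℕ) → .{{NonZero l}} → Set
a ≡ b [mod l ] = a % l ≡ b % l

module _ {l : ℕ} .{{_ : NonZero l}} where

  +-cong-mod : ∀ {a a′ b b′} → a ≡ a′ [mod l ] → b ≡ b′ [mod l ] → a + b ≡ a′ + b′ [mod l ]
  +-cong-mod {a} {a′} {b} {b′} a≡a′ b≡b′ =
    trans (%-distribˡ-+ a b l) (trans (cong₂ (λ x y → (x + y) % l) a≡a′ b≡b′) (sym (%-distribˡ-+ a′ b′ l)))

  *-cong-mod : ∀ {a a′ b b′} → a ≡ a′ [mod l ] → b ≡ b′ [mod l ] → a * b ≡ a′ * b′ [mod l ]
  *-cong-mod {a} {a′} {b} {b′} a≡a′ b≡b′ =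
    trans (%-distribˡ-* a b l) (trans (cong₂ (λ x y → (x * y) % l) a≡a′ b≡b′) (sym (%-distribˡ-* a′ b′ l)))

  ∑-δ-≤ : ∀ {M Y} (g : ℕ → ℕ) → Y ≤ M → g M ≡ 0 [mod l ] →
          ∑[ a < M ] (⟦ toℕ a ≡ᵇ Y ⟧ * g (toℕ a)) ≡ g Y [mod l ]
  ∑-δ-≤ {M} g Y≤M gM≡0 with m≤n⇒m<n∨m≡n Y≤M
  ... | inj₁ Y<M  = cong (_% l) (∑-δ g Y<M)
  ... | inj₂ refl = trans (cong (_% l) (∑-δ-out {Y = M} g ≤-refl)) (sym gM≡0)

-- Covering by products of balanced arcs

module Counting {G : Graph V} (_≟_ : DecidableEquality V) where

  ends-at : Bool → V → Arc G → Bool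
  ends-at x y ε = does (endpoint ε x ≟ y)

  ends-at-exclusive : (ε : Arc G) (y : V) → T (ends-at true y ε) → T (ends-at false y ε) → ⊥
  ends-at-exclusive ε y with tail ε ≟ y | head ε ≟ y
  ... | yes tail≡y | yes head≡y = λ _ _ → tail≢head ε (trans tail≡y (sym head≡y))
  ... | yes _      | no _       = λ _ ()
  ... | no _       | _          = λ ()

  ends-at-reverse : ∀ x y (ε : Arc G) → ends-at x y (reverse ε) ≡ ends-at (not x) y ε
  ends-at-reverse true  y ε = refl
  ends-at-reverse false y ε = refl

  count-back-and-forth : ∀ x y (u d : ℕ) (ε : Arc G) →
    count (ends-at x y) (back-and-forth u d ε) ≡ ⟦ ends-at x y ε ⟧ * u + ⟦ ends-at (not x) y ε ⟧ * d
  count-back-and-forth x y u d ε =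
    trans (count-++ (ends-at x y) (replicate u ε) _)
          (cong₂ _+_ (count-replicate (ends-at x y) u ε)
                     (trans (count-replicate (ends-at x y) d (reverse ε))
                            (cong (λ b → ⟦ b ⟧ * d) (ends-at-reverse x y ε))))

  hits : {S : Pred (Vec Bool k) ℓ} → Decidable S → Vec (Arc G) k → Vec V k → Bool
  hits S? []      []      = does (S? [])
  hits S? (ε ∷ E) (y ∷ v) =
    if ends-at true y ε then hits (S? ∘ (true ∷_)) E v
    else if ends-at false y ε then hits (S? ∘ (false ∷_)) E v
    else false

  hits-sound : {S : Pred (Vec Bool k) ℓ} (S? : Decidable S) (E : Vec (Arc G) k) (v : Vec V k) →
               T (hits S? E v) → ∃ λ x → S x × cube E x ≡ v
  hits-sound S? []      []      h with S? []
  ... | yes S[] = [] , S[] , refl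
  hits-sound S? (ε ∷ E) (y ∷ v) h with tail ε ≟ y
  ... | yes tail≡y = let x , Sx , Ex≡v = hits-sound (S? ∘ (true ∷_)) E v h in
                     true ∷ x , Sx , cong₂ _∷_ tail≡y Ex≡v
  ... | no _ with head ε ≟ y
  ...   | yes head≡y = let x , Sx , Ex≡v = hits-sound (S? ∘ (false ∷_)) E v h in
                       false ∷ x , Sx , cong₂ _∷_ head≡y Ex≡v
  ...   | no _ = ⊥-elim h

  hits-complete : {S : Pred (Vec Bool k) ℓ} (S? : Decidable S) (E : Vec (Arc G) k) (x : Vec Bool k) →
                  S x → T (hits S? E (cube E x))
  hits-complete S? []      []          Sx with S? []
  ... | yes _   = _
  ... | no ¬S[] = ¬S[] Sx
  hits-complete S? (ε ∷ E) (true ∷ x)  Sx with tail ε ≟ tail ε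
  ... | yes _   = hits-complete (S? ∘ (true ∷_)) E x Sx
  ... | no t≢t  = ⊥-elim (t≢t refl)
  hits-complete S? (ε ∷ E) (false ∷ x) Sx with tail ε ≟ head ε
  ... | yes t≡h = ⊥-elim (tail≢head ε t≡h)
  ... | no _ with head ε ≟ head ε
  ...   | yes _   = hits-complete (S? ∘ (false ∷_)) E x Sx
  ...   | no h≢h  = ⊥-elim (h≢h refl)

  hits-spec : {S : Pred (Vec Bool k) ℓ} (S? : Decidable S) (E : Vec (Arc G) k) (v : Vec V k) →
              T (hits S? E v) ⇔ (∃ λ x → S x × cube E x ≡ v)
  hits-spec S? E v = mk⇔ (hits-sound S? E v) λ { (x , Sx , refl) → hits-complete S? E x Sx }

  module _ (l : ℕ) .{{_ : NonZero l}} where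

    record Balanced (L : Bool → List (Arc G)) : Set where
      field
        tails : ∀ b y → count (ends-at true y) (L b) ≡ ⟦ b ⟧ [mod l ]
        heads : ∀ b y → count (ends-at false y) (L b) ≡ ⟦ not b ⟧ [mod l ]
    open Balanced

    balanced-orient : (L : List (Arc G)) →
                      (∀ y → count (ends-at true y) L ≡ 1 [mod l ] × count (ends-at false y) L ≡ 0 [mod l ]) →
                      Balanced (orient L)
    balanced-orient L once = record
      { tails = λ { true y  → proj₁ (once y)
                  ; false y → trans (cong (_% l) (count-map (ends-at true y) reverse L)) (proj₂ (once y)) }
      ; heads = λ { true y  → proj₂ (once y)
                  ; false y → trans (cong (_% l) (count-map (ends-at false y) reverse L)) (proj₁ (once y)) }
      }

    count-hits : {L : Bool → List (Arc G)} → Balanced L →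
                 {S : Pred (Vec Bool k) ℓ} (S? : Decidable S) (c : Vec Bool k) (v : Vec V k) →
                 count (λ E → hits S? E v) (cubes L c) ≡ ⟦ does (S? c) ⟧ [mod l ]
    count-hits bal S? []      []      = cong (_% l) (+-identityʳ _)
    count-hits {L = L} bal S? (b ∷ c) (y ∷ v) = begin
      count (λ E → hits S? E (y ∷ v)) (cartesianProductWith _∷_ (L b) (cubes L c)) % l
        ≡⟨ cong (_% l) (count-cartesianProductWith _ _∷_ (L b) (cubes L c)) ⟩
      sum (map (λ ε → count (λ E → hits S? (ε ∷ E) (y ∷ v)) (cubes L c)) (L b)) % l
        ≡⟨ cong (_% l) (cong sum (map-cong split (L b))) ⟩
      sum (map (λ ε → ⟦ ends-at true y ε ⟧ * Nᵗ + ⟦ ends-at false y ε ⟧ * Nᶠ) (L b)) % l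
        ≡⟨ cong (_% l) (sum-count-linear (ends-at true y) (ends-at false y) Nᵗ Nᶠ (L b)) ⟩
      (count (ends-at true y) (L b) * Nᵗ + count (ends-at false y) (L b) * Nᶠ) % l
        ≡⟨ +-cong-mod (*-cong-mod (tails bal b y) IHᵗ) (*-cong-mod (heads bal b y) IHᶠ) ⟩
      (⟦ b ⟧ * ⟦ does (S? (true ∷ c)) ⟧ + ⟦ not b ⟧ * ⟦ does (S? (false ∷ c)) ⟧) % l
        ≡⟨ cong (_% l) (select b) ⟩
      ⟦ does (S? (b ∷ c)) ⟧ % l ∎
      where
      open ≡-Reasoning
      Nᵗ Nᶠ : ℕ
      Nᵗ = count (λ E → hits (S? ∘ (true ∷_)) E v) (cubes L c)
      Nᶠ = count (λ E → hits (S? ∘ (false ∷_)) E v) (cubes L c)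
      IHᵗ = count-hits bal (S? ∘ (true ∷_)) c v
      IHᶠ = count-hits bal (S? ∘ (false ∷_)) c v
      split : ∀ ε → count (λ E → hits S? (ε ∷ E) (y ∷ v)) (cubes L c)
                  ≡ ⟦ ends-at true y ε ⟧ * Nᵗ + ⟦ ends-at false y ε ⟧ * Nᶠ
      split ε = count-if (ends-at true y ε) (ends-at false y ε) _ _ (ends-at-exclusive ε y) (cubes L c)
      select : ∀ b → ⟦ b ⟧ * ⟦ does (S? (true ∷ c)) ⟧ + ⟦ not b ⟧ * ⟦ does (S? (false ∷ c)) ⟧
                   ≡ ⟦ does (S? (b ∷ c)) ⟧
      select true  = trans (+-identityʳ _) (+-identityʳ _)
      select false = +-identityʳ _

balanced⇒partition : ∀ {n m k} {R : Fin (suc n) → Fin (suc n) → Set} {L : Bool → List (Arc (path m))} →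
                     Counting.Balanced Fin._≟_ (suc n) L → InducedEmb R (QAdj k) →
                     One-mod-Partition (suc n) m k R
balanced⇒partition {n} {m} {k} {R} {L} bal e = map copy (cubes L c) , covered-once
  where
  open Counting {G = path m} Fin._≟_
  open ≡-Reasoning
  c = f e zero
  copy : Vec (Arc (path m)) k → InducedEmb R (PowAdj (PAdj m) k)
  copy E = cubeᵉ E ∘ᵉ (idᵉ (QAdj⇔PowAdj k) ∘ᵉ e)
  image? : Decidable (λ x → ∃ λ u → f e u ≡ x)
  image? x = any? λ u → ≡-dec Bool._≟_ (f e u) x
  covers⇔hits : ∀ v E → (∃ λ u → f (copy E) u ≡ v) ⇔ T (hits image? E v)
  covers⇔hits v E = ⇔-sym (hits-spec image? E v) ⇔-∘
    mk⇔ (λ (u , p) → f e u , (u , refl) , p) λ { (_ , (u , refl) , p) → u , p }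
  covered-once : ∀ v → multiplicity (map copy (cubes L c)) v % suc n ≡ 1 % suc n
  covered-once v = begin
    length (filter (covers? v) (map copy (cubes L c))) % suc n
      ≡⟨ cong (_% suc n) (length-filter (covers? v) (map copy (cubes L c))) ⟩
    count (does ∘ covers? v) (map copy (cubes L c)) % suc n
      ≡⟨ cong (_% suc n) (count-map _ copy (cubes L c)) ⟩
    count (does ∘ covers? v ∘ copy) (cubes L c) % suc n
      ≡⟨ cong (_% suc n) (count-cong (λ E → does-⇔ (covers⇔hits v E) (covers? v (copy E)) (T? _)) (cubes L c)) ⟩
    count (λ E → hits image? E v) (cubes L c) % suc n
      ≡⟨ count-hits (suc n) bal image? c v ⟩
    ⟦ does (image? c) ⟧ % suc n
      ≡⟨ cong (λ b → ⟦ b ⟧ % suc n) (dec-true (image? c) (zero , refl)) ⟩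
    1 % suc n ∎

-- Balanced arcs on the path with 2l vertices

does-≟-toℕ : ∀ {m} (i j : Fin m) → does (i Fin.≟ j) ≡ (toℕ i ≡ᵇ toℕ j)
does-≟-toℕ zero    zero    = refl
does-≟-toℕ zero    (suc j) = refl
does-≟-toℕ (suc i) zero    = refl
does-≟-toℕ (suc i) (suc j) = does-≟-toℕ i j

-- M = 2l − 1 is the number of edges; taking it as a parameter lets the use site pass refl,
-- so that path (suc M) is definitionally path (2 * l).
module ZigZag (l : ℕ) .{{_ : NonZero l}} (M : ℕ) (2l≡1+M : 2 * l ≡ suc M) where

  1+M≡l+l : suc M ≡ l + l
  1+M≡l+l = trans (sym 2l≡1+M) (cong (l +_) (+-identityʳ l))

  ⌈/2⌉≤l : ∀ {Y} → Y ≤ M → ⌈ Y /2⌉ ≤ l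
  ⌈/2⌉≤l {Y} Y≤M =
    subst (⌈ Y /2⌉ ≤_) (sym (n≡⌈n+n/2⌉ l)) (⌈n/2⌉-mono (subst (Y ≤_) 1+M≡l+l (m≤n⇒m≤1+n Y≤M)))

  -- Vertex a is the tail of up a + down (a − 1) = l + 1 arcs and the head of
  -- up (a − 1) + down a = l arcs; at the ends the missing terms are up M ≡ 0 and down M = 0.
  up down : ℕ → ℕ
  up a   = ⌈ suc a /2⌉
  down a = l ∸ ⌈ a /2⌉

  up-M : up M ≡ 0 [mod l ]
  up-M = trans (cong (_% l) (trans (cong ⌈_/2⌉ 1+M≡l+l) (sym (n≡⌈n+n/2⌉ l)))) ([m+n]%n≡m%n 0 l)

  down-M : down M ≡ 0
  down-M = trans (cong (l ∸_) (trans (cong ⌊_/2⌋ 1+M≡l+l) (sym (n≡⌊n+n/2⌋ l)))) (n∸n≡0 l)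

  step : Fin M → Arc (path (suc M))
  step a = arc (inject₁ a) (suc a) (inj₁ (cong suc (toℕ-inject₁ a)))

  zigzag : List (Arc (path (suc M)))
  zigzag = concat (tabulate λ a → back-and-forth (up (toℕ a)) (down (toℕ a)) (step a))

  open Counting {G = path (suc M)} Fin._≟_
  open ≡-Reasoning

  weight : Bool → Fin (suc M) → (ℕ → ℕ) → ℕ
  weight x y g = ∑[ a < M ] (⟦ ends-at x y (step a) ⟧ * g (toℕ a))

  count-zigzag : ∀ x y → count (ends-at x y) zigzag ≡ weight x y up + weight (not x) y down
  count-zigzag x y =
    trans (count-concat-tabulate (ends-at x y) (λ a → back-and-forth (up (toℕ a)) (down (toℕ a)) (step a)))
    (trans (sum-cong-≗ λ a → count-back-and-forth x y (up (toℕ a)) (down (toℕ a)) (step a))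
           (∑-distrib-+ (λ a → ⟦ ends-at x y (step a) ⟧ * up (toℕ a))
                        (λ a → ⟦ ends-at (not x) y (step a) ⟧ * down (toℕ a))))

  weight-tail : ∀ y (g : ℕ → ℕ) → g M ≡ 0 [mod l ] → weight true y g ≡ g (toℕ y) [mod l ]
  weight-tail y g gM≡0 =
    trans (cong (_% l) (sum-cong-≗ λ a → cong (λ b → ⟦ b ⟧ * g (toℕ a))
                          (trans (does-≟-toℕ (inject₁ a) y) (cong (_≡ᵇ toℕ y) (toℕ-inject₁ a)))))
          (∑-δ-≤ g (≤-pred (toℕ<n y)) gM≡0)

  weight-head-zero : ∀ (g : ℕ → ℕ) → weight false zero g ≡ 0
  weight-head-zero g = sum-replicate-zero M

  weight-head-suc : ∀ y (g : ℕ → ℕ) → weight false (suc y) g ≡ g (toℕ y)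
  weight-head-suc y g =
    trans (sum-cong-≗ λ a → cong (λ b → ⟦ b ⟧ * g (toℕ a)) (does-≟-toℕ a y)) (∑-δ g (toℕ<n y))

  tails-once : ∀ y → count (ends-at true y) zigzag ≡ 1 [mod l ]
  tails-once zero = begin
    count (ends-at true zero) zigzag % l
      ≡⟨ cong (_% l) (count-zigzag true zero) ⟩
    (weight true zero up + weight false zero down) % l
      ≡⟨ +-cong-mod (weight-tail zero up up-M) (cong (_% l) (weight-head-zero down)) ⟩
    1 % l ∎
  tails-once (suc y) = begin
    count (ends-at true (suc y)) zigzag % l
      ≡⟨ cong (_% l) (count-zigzag true (suc y)) ⟩
    (weight true (suc y) up + weight false (suc y) down) % l
      ≡⟨ +-cong-mod (weight-tail (suc y) up up-M) (cong (_% l) (weight-head-suc y down)) ⟩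
    (up (suc (toℕ y)) + down (toℕ y)) % l
      ≡⟨ cong (λ z → suc z % l) (m+[n∸m]≡n (⌈/2⌉≤l (<⇒≤ (toℕ<n y)))) ⟩
    suc l % l
      ≡⟨ [m+n]%n≡m%n 1 l ⟩
    1 % l ∎

  heads-once : ∀ y → count (ends-at false y) zigzag ≡ 0 [mod l ]
  heads-once zero = begin
    count (ends-at false zero) zigzag % l
      ≡⟨ cong (_% l) (count-zigzag false zero) ⟩
    (weight false zero up + weight true zero down) % l
      ≡⟨ +-cong-mod (cong (_% l) (weight-head-zero up)) (weight-tail zero down (cong (_% l) down-M)) ⟩
    l % l
      ≡⟨ [m+n]%n≡m%n 0 l ⟩
    0 % l ∎
  heads-once (suc y) = begin
    count (ends-at false (suc y)) zigzag % l
      ≡⟨ cong (_% l) (count-zigzag false (suc y)) ⟩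
    (weight false (suc y) up + weight true (suc y) down) % l
      ≡⟨ +-cong-mod (cong (_% l) (weight-head-suc y up)) (weight-tail (suc y) down (cong (_% l) down-M)) ⟩
    (up (toℕ y) + down (suc (toℕ y))) % l
      ≡⟨ cong (_% l) (m+[n∸m]≡n (⌈/2⌉≤l (toℕ<n y))) ⟩
    l % l
      ≡⟨ [m+n]%n≡m%n 0 l ⟩
    0 % l ∎

  balanced : Balanced l (orient zigzag)
  balanced = balanced-orient l zigzag λ y → tails-once y , heads-once y

theorem7 : (n : ℕ) (H : Graph (Fin (suc n))) (k : ℕ)
    → InducedEmb (Adj H) (QAdj k)
    → One-mod-Partition (suc n) (2 * suc n) k (Adj H)
theorem7 n H k = balanced⇒partition (ZigZag.balanced (suc n) _ refl)
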